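{- Let $\hbox{Repl}$ be the rule which, for terms $s,r$, an atomic formula $P$, a variable $v$ not occurring in $s$ or $r$, and finite multisets of formulas $\Gamma,\Delta$, infers $$ s=r,\ P[v/s],\ \Gamma\Rightarrow \Delta \quad\text{from}\quad s=r,\ P[v/s],\ P[v/r],\ \Gamma\Rightarrow \Delta ,$$ and let $\hbox{Repl}_1$ be the same rule restricted to instances in which $v$ has exactly one occurrence in $P$. Then $\hbox{Repl}$ is derivable from $\hbox{Repl}_1$ together with the left weakening rule (from $\Gamma\Rightarrow\Delta$ infer $F,\Gamma\Rightarrow\Delta$): every instance of $\hbox{Repl}$ can be obtained by finitely many applications of $\hbox{Repl}_1$ and left weakening.
   Context: Sequents $\Gamma\Rightarrow\Delta$ have finite multisets of first-order formulas (in a language with function symbols and equality) on both sides. $P[v/t]$ denotes the result of substituting the term $t$ for the variable $v$ in $P$. -}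

module Defs where

open import Data.Nat using (ℕ; zero; suc; _+_; _≡ᵇ_)
open import Data.Bool using (if_then_else_)
open import Data.List using (List; []; _∷_)
open import Data.Product using (_×_; _,_)
open import Data.Sum using (_⊎_)
open import Relation.Binary.PropositionalEquality using (_≡_)
open import Data.List.Relation.Binary.Permutation.Propositional using (_↭_)

Var : Set
Var = ℕ

data Term : Set where
  var : Var → Term
  fun : ℕ → List Term → Term

data Atom : Set where
  pred : ℕ → List Term → Atom
  _≐_  : Term → Term → Atom

data Formula : Set where
  atom     : Atom → Formula
  ⊥̇        : Formula
  _∧̇_ _∨̇_ _⇒̇_ : Formula → Formula → Formula
  ∀̇ ∃̇      : Var → Formula → Formula

mutual
  substT : Var → Term → Term → Term
  substT v t (var w) = if v ≡ᵇ w then t else var w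
  substT v t (fun f ts) = fun f (substTs v t ts)

  substTs : Var → Term → List Term → List Term
  substTs v t [] = []
  substTs v t (u ∷ us) = substT v t u ∷ substTs v t us

_[_/_] : Atom → Var → Term → Atom
pred p ts [ v / t ] = pred p (substTs v t ts)
(a ≐ b)   [ v / t ] = substT v t a ≐ substT v t b

mutual
  occT : Var → Term → ℕ
  occT v (var w) = if v ≡ᵇ w then 1 else 0
  occT v (fun f ts) = occTs v ts

  occTs : Var → List Term → ℕ
  occTs v [] = 0
  occTs v (u ∷ us) = occT v u + occTs v us

occA : Var → Atom → ℕ
occA v (pred p ts) = occTs v ts
occA v (a ≐ b) = occT v a + occT v b

-- sequents: pairs of finite multisets (lists up to permutation)
Seq : Set
Seq = List Formula × List Formula

_≈ₛ_ : Seq → Seq → Set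
(Γ , Δ) ≈ₛ (Γ' , Δ') = (Γ ↭ Γ') × (Δ ↭ Δ')

-- one-premise rules: relation premise ↦ conclusion
Rule : Set₁
Rule = Seq → Seq → Set

_∪ᴿ_ : Rule → Rule → Rule
(R ∪ᴿ R') A B = R A B ⊎ R' A B

data Repl₁ : Rule where
  repl₁ : ∀ s r P v Γ Δ → occT v s ≡ 0 → occT v r ≡ 0 → occA v P ≡ 1 →
          Repl₁ (atom (s ≐ r) ∷ atom (P [ v / s ]) ∷ atom (P [ v / r ]) ∷ Γ , Δ)
                (atom (s ≐ r) ∷ atom (P [ v / s ]) ∷ Γ , Δ)

data LW : Rule where
  lw : ∀ F Γ Δ → LW (Γ , Δ) (F ∷ Γ , Δ)

data Derives (R : Rule) (S : Seq) : Seq → Set where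
  hyp  : ∀ {C} → S ≈ₛ C → Derives R S C
  step : ∀ {A B C} → Derives R S A → R A B → B ≈ₛ C → Derives R S C

{-# OPTIONS --safe #-}
-- Let n ≥ 1 be the number of occurrences of v in P and let Xₖ be P with its
-- first k occurrences of v replaced by r and the others by s, so X₀ = P[v/s]
-- and Xₙ = P[v/r].  Keeping only the k-th occurrence as v gives an atom Qₖ
-- with exactly one occurrence of v, Qₖ[v/s] = Xₖ and Qₖ[v/r] = Xₖ₊₁; hence
-- Repl₁ drops Xₖ₊₁ in the presence of s = r and Xₖ.  Starting from
-- s = r, X₀, Xₙ, Γ we weaken in Xₙ₋₁, drop Xₙ, weaken in Xₙ₋₂, drop Xₙ₋₁, …,
-- until only s = r, X₀, Γ remains.
module Submission where

open import Defs
open import Data.Nat using (_≤_)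
open import Data.List using (List; _∷_)
open import Data.Product using (_,_)
open import Relation.Binary.PropositionalEquality using (_≡_)

open import Data.Bool using (true; false; if_then_else_)
open import Data.Bool.Properties using (T-≡)
open import Data.List using ([])
open import Data.List.Relation.Binary.Permutation.Propositional as ↭ using (prep; swap)
open import Data.Nat using (ℕ; zero; suc; _+_; _<_; _≡ᵇ_; s≤s; z≤n)
open import Data.Nat.Properties
  using (+-assoc; +-identityʳ; ≤-refl; m≤n⇒m≤1+n; m≤m+n; +-monoʳ-<; <-≤-trans;
         m+n≡0⇒m≡0; m+n≡0⇒n≡0; ≡⇒≡ᵇ)
open import Data.Sum using (inj₁; inj₂)
open import Function using (_∘_)
open import Function.Bundles using (Equivalence)
open import Relation.Binary.PropositionalEquality
  using (_≗_; refl; sym; trans; cong; cong₂; subst₂; module ≡-Reasoning)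

sumBelow : (ℕ → ℕ) → ℕ → ℕ
sumBelow f zero    = 0
sumBelow f (suc n) = f 0 + sumBelow (f ∘ suc) n

sumBelow-+ : ∀ f m n → sumBelow f (m + n) ≡ sumBelow f m + sumBelow (λ i → f (m + i)) n
sumBelow-+ f zero    n = refl
sumBelow-+ f (suc m) n =
  trans (cong (f 0 +_) (sumBelow-+ (f ∘ suc) m n)) (sym (+-assoc (f 0) _ _))

sumBelow-cong : ∀ {f g} → f ≗ g → ∀ n → sumBelow f n ≡ sumBelow g n
sumBelow-cong f≗g zero    = refl
sumBelow-cong f≗g (suc n) = cong₂ _+_ (f≗g 0) (sumBelow-cong (f≗g ∘ suc) n)

sumBelow-zero : ∀ n → sumBelow (λ _ → 0) n ≡ 0
sumBelow-zero zero    = refl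
sumBelow-zero (suc n) = sumBelow-zero n

module _ {A : Set} where

  switchAt : A → A → ℕ → ℕ → A
  switchAt a c zero    i       = c
  switchAt a c (suc k) zero    = a
  switchAt a c (suc k) (suc i) = switchAt a c k i

  markAt : A → A → A → ℕ → ℕ → A
  markAt a b c zero    zero    = b
  markAt a b c zero    (suc i) = c
  markAt a b c (suc k) zero    = a
  markAt a b c (suc k) (suc i) = markAt a b c k i

  switchAt-below : ∀ {a c k i} → i < k → switchAt a c k i ≡ a
  switchAt-below {k = suc k} {zero}  i<k       = refl
  switchAt-below {k = suc k} {suc i} (s≤s i<k) = switchAt-below i<k

  markAt-switchAt : ∀ {a c} k i → markAt a c c k i ≡ switchAt a c k i
  markAt-switchAt zero    zero    = refl
  markAt-switchAt zero    (suc i) = refl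
  markAt-switchAt (suc k) zero    = refl
  markAt-switchAt (suc k) (suc i) = markAt-switchAt k i

  markAt-switchAt-suc : ∀ {a c} k i → markAt a a c k i ≡ switchAt a c (suc k) i
  markAt-switchAt-suc zero    zero    = refl
  markAt-switchAt-suc zero    (suc i) = refl
  markAt-switchAt-suc (suc k) zero    = refl
  markAt-switchAt-suc (suc k) (suc i) = markAt-switchAt-suc k i

markAt-map : ∀ {A B : Set} (f : A → B) {a b c a′ b′ c′} →
             f a ≡ a′ → f b ≡ b′ → f c ≡ c′ →
             ∀ k i → f (markAt a b c k i) ≡ markAt a′ b′ c′ k i
markAt-map f fa fb fc zero    zero    = fb
markAt-map f fa fb fc zero    (suc i) = fc
markAt-map f fa fb fc (suc k) zero    = fa
markAt-map f fa fb fc (suc k) (suc i) = markAt-map f fa fb fc k i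

sumBelow-markAt : ∀ {k n} → k < n → sumBelow (markAt 0 1 0 k) n ≡ 1
sumBelow-markAt {zero}  {suc n} k<n       = cong suc (sumBelow-zero n)
sumBelow-markAt {suc k} {suc n} (s≤s k<n) = sumBelow-markAt k<n

-- substOccT g u replaces the i-th occurrence of v in u (counted from the
-- left, starting at 0) by g i.
module OccurrenceSubstitution (v : Var) where

  mutual
    substOccT : (ℕ → Term) → Term → Term
    substOccT g (var w)    = if v ≡ᵇ w then g 0 else var w
    substOccT g (fun f ts) = fun f (substOccTs g ts)

    substOccTs : (ℕ → Term) → List Term → List Term
    substOccTs g []       = []
    substOccTs g (u ∷ us) = substOccT g u ∷ substOccTs (λ i → g (occT v u + i)) us

  substOccA : (ℕ → Term) → Atom → Atom
  substOccA g (pred p ts) = pred p (substOccTs g ts)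
  substOccA g (a ≐ b)     = substOccT g a ≐ substOccT (λ i → g (occT v a + i)) b

  v≡ᵇv : (v ≡ᵇ v) ≡ true
  v≡ᵇv = Equivalence.to T-≡ (≡⇒≡ᵇ v v refl)

  substT-var-self : ∀ t → substT v t (var v) ≡ t
  substT-var-self t rewrite v≡ᵇv = refl

  occT-var-self : occT v (var v) ≡ 1
  occT-var-self rewrite v≡ᵇv = refl

  mutual
    substT-fresh : ∀ t {u} → occT v u ≡ 0 → substT v t u ≡ u
    substT-fresh t {var w} fresh with v ≡ᵇ w
    ... | false = refl
    substT-fresh t {fun f ts} fresh = cong (fun f) (substTs-fresh t fresh)

    substTs-fresh : ∀ t {us} → occTs v us ≡ 0 → substTs v t us ≡ us
    substTs-fresh t {[]}     fresh = refl
    substTs-fresh t {u ∷ us} fresh =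
      cong₂ _∷_ (substT-fresh t (m+n≡0⇒m≡0 _ fresh)) (substTs-fresh t (m+n≡0⇒n≡0 (occT v u) fresh))

  mutual
    substOccT-cong : ∀ {g g′} u → (∀ i → i < occT v u → g i ≡ g′ i) →
                     substOccT g u ≡ substOccT g′ u
    substOccT-cong (var w) g≡g′ with v ≡ᵇ w
    ... | true  = g≡g′ 0 (s≤s z≤n)
    ... | false = refl
    substOccT-cong (fun f ts) g≡g′ = cong (fun f) (substOccTs-cong ts g≡g′)

    substOccTs-cong : ∀ {g g′} us → (∀ i → i < occTs v us → g i ≡ g′ i) →
                      substOccTs g us ≡ substOccTs g′ us
    substOccTs-cong []       g≡g′ = refl
    substOccTs-cong (u ∷ us) g≡g′ =
      cong₂ _∷_ (substOccT-cong u (λ i i< → g≡g′ i (<-≤-trans i< (m≤m+n _ _))))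
                (substOccTs-cong us (λ i i< → g≡g′ (occT v u + i) (+-monoʳ-< (occT v u) i<)))

  substOccA-cong : ∀ {g g′} P → (∀ i → i < occA v P → g i ≡ g′ i) →
                   substOccA g P ≡ substOccA g′ P
  substOccA-cong (pred p ts) g≡g′ = cong (pred p) (substOccTs-cong ts g≡g′)
  substOccA-cong (a ≐ b)     g≡g′ =
    cong₂ _≐_ (substOccT-cong a (λ i i< → g≡g′ i (<-≤-trans i< (m≤m+n _ _))))
              (substOccT-cong b (λ i i< → g≡g′ (occT v a + i) (+-monoʳ-< (occT v a) i<)))

  mutual
    substOccT-const : ∀ t u → substOccT (λ _ → t) u ≡ substT v t u
    substOccT-const t (var w)    = refl
    substOccT-const t (fun f ts) = cong (fun f) (substOccTs-const t ts)

    substOccTs-const : ∀ t us → substOccTs (λ _ → t) us ≡ substTs v t us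
    substOccTs-const t []       = refl
    substOccTs-const t (u ∷ us) = cong₂ _∷_ (substOccT-const t u) (substOccTs-const t us)

  substOccA-const : ∀ t P → substOccA (λ _ → t) P ≡ P [ v / t ]
  substOccA-const t (pred p ts) = cong (pred p) (substOccTs-const t ts)
  substOccA-const t (a ≐ b)     = cong₂ _≐_ (substOccT-const t a) (substOccT-const t b)

  mutual
    substT-substOccT : ∀ t g u → substT v t (substOccT g u) ≡ substOccT (substT v t ∘ g) u
    substT-substOccT t g (var w) with v ≡ᵇ w in v≡ᵇw
    ... | true  = refl
    ... | false rewrite v≡ᵇw = refl
    substT-substOccT t g (fun f ts) = cong (fun f) (substTs-substOccTs t g ts)

    substTs-substOccTs : ∀ t g us → substTs v t (substOccTs g us) ≡ substOccTs (substT v t ∘ g) us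
    substTs-substOccTs t g []       = refl
    substTs-substOccTs t g (u ∷ us) = cong₂ _∷_ (substT-substOccT t g u) (substTs-substOccTs t _ us)

  subst-substOccA : ∀ t g P → substOccA g P [ v / t ] ≡ substOccA (substT v t ∘ g) P
  subst-substOccA t g (pred p ts) = cong (pred p) (substTs-substOccTs t g ts)
  subst-substOccA t g (a ≐ b)     = cong₂ _≐_ (substT-substOccT t g a) (substT-substOccT t _ b)

  mutual
    occT-substOccT : ∀ g u → occT v (substOccT g u) ≡ sumBelow (occT v ∘ g) (occT v u)
    occT-substOccT g (var w) with v ≡ᵇ w in v≡ᵇw
    ... | true  = sym (+-identityʳ _)
    ... | false rewrite v≡ᵇw = refl
    occT-substOccT g (fun f ts) = occTs-substOccTs g ts

    occTs-substOccTs : ∀ g us → occTs v (substOccTs g us) ≡ sumBelow (occT v ∘ g) (occTs v us)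
    occTs-substOccTs g []       = refl
    occTs-substOccTs g (u ∷ us) =
      trans (cong₂ _+_ (occT-substOccT g u) (occTs-substOccTs _ us))
            (sym (sumBelow-+ _ (occT v u) (occTs v us)))

  occA-substOccA : ∀ g P → occA v (substOccA g P) ≡ sumBelow (occT v ∘ g) (occA v P)
  occA-substOccA g (pred p ts) = occTs-substOccTs g ts
  occA-substOccA g (a ≐ b)     =
    trans (cong₂ _+_ (occT-substOccT g a) (occT-substOccT _ b))
          (sym (sumBelow-+ _ (occT v a) (occT v b)))

≈ₛ-refl : ∀ {A} → A ≈ₛ A
≈ₛ-refl = ↭.refl , ↭.refl

≈ₛ-trans : ∀ {A B C} → A ≈ₛ B → B ≈ₛ C → A ≈ₛ C
≈ₛ-trans (Γ↭ , Δ↭) (Γ↭′ , Δ↭′) = ↭.trans Γ↭ Γ↭′ , ↭.trans Δ↭ Δ↭′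

module _ {R : Rule} where

  Derives-≈ₛ : ∀ {A B C} → Derives R A B → B ≈ₛ C → Derives R A C
  Derives-≈ₛ (hyp A≈B)          B≈C = hyp (≈ₛ-trans A≈B B≈C)
  Derives-≈ₛ (step d rule B′≈B) B≈C = step d rule (≈ₛ-trans B′≈B B≈C)

  Derives-trans : ∀ {A B C} → Derives R A B → Derives R B C → Derives R A C
  Derives-trans d (hyp B≈C)          = Derives-≈ₛ d B≈C
  Derives-trans d (step d′ rule C′≈C) = step (Derives-trans d d′) rule C′≈C

  Derives-rule : ∀ {A B} → R A B → Derives R A B
  Derives-rule rule = step (hyp ≈ₛ-refl) rule ≈ₛ-refl

drop-chain-end : ∀ {R : Rule} (E : Formula) (X : ℕ → Formula) {Δ} n →
                 (∀ {Γ} k → k < n → R (E ∷ X k ∷ X (suc k) ∷ Γ , Δ) (E ∷ X k ∷ Γ , Δ)) →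
                 ∀ Γ → 1 ≤ n → Derives (R ∪ᴿ LW) (E ∷ X 0 ∷ X n ∷ Γ , Δ) (E ∷ X 0 ∷ Γ , Δ)
drop-chain-end E X (suc zero) drop Γ _ = Derives-rule (inj₁ (drop 0 ≤-refl))
drop-chain-end E X {Δ} (suc (suc m)) drop Γ _ =
  Derives-trans
    (step (step (hyp ≈ₛ-refl)
                (inj₂ (lw (X (suc m)) _ Δ))
                (swap _ _ (swap _ _ ↭.refl) , ↭.refl))
          (inj₁ (drop (suc m) ≤-refl))
          (prep _ (swap _ _ ↭.refl) , ↭.refl))
    (drop-chain-end E X (suc m) (λ k k<n → drop k (m≤n⇒m≤1+n k<n)) Γ (s≤s z≤n))

module Interpolation (v : Var) (s r : Term) (s-fresh : occT v s ≡ 0) (r-fresh : occT v r ≡ 0)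
                     (P : Atom) where
  open OccurrenceSubstitution v

  interpolant : ℕ → Atom
  interpolant k = substOccA (switchAt r s k) P

  pivot : ℕ → Atom
  pivot k = substOccA (markAt r (var v) s k) P

  substT-pivot : ∀ t k i → substT v t (markAt r (var v) s k i) ≡ markAt r t s k i
  substT-pivot t =
    markAt-map (substT v t) (substT-fresh t r-fresh) (substT-var-self t) (substT-fresh t s-fresh)

  occT-pivot : ∀ k i → occT v (markAt r (var v) s k i) ≡ markAt 0 1 0 k i
  occT-pivot = markAt-map (occT v) r-fresh occT-var-self s-fresh

  pivot-s : ∀ k → pivot k [ v / s ] ≡ interpolant k
  pivot-s k = trans (subst-substOccA s _ P)
                    (substOccA-cong P (λ i _ → trans (substT-pivot s k i) (markAt-switchAt k i)))

  pivot-r : ∀ k → pivot k [ v / r ] ≡ interpolant (suc k)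
  pivot-r k = trans (subst-substOccA r _ P)
                    (substOccA-cong P (λ i _ → trans (substT-pivot r k i) (markAt-switchAt-suc k i)))

  occA-pivot : ∀ {k} → k < occA v P → occA v (pivot k) ≡ 1
  occA-pivot {k} k<n = begin
    occA v (pivot k)                                    ≡⟨ occA-substOccA _ P ⟩
    sumBelow (occT v ∘ markAt r (var v) s k) (occA v P) ≡⟨ sumBelow-cong (occT-pivot k) (occA v P) ⟩
    sumBelow (markAt 0 1 0 k) (occA v P)                ≡⟨ sumBelow-markAt k<n ⟩
    1                                                   ∎
    where open ≡-Reasoning

  interpolant-zero : interpolant 0 ≡ P [ v / s ]
  interpolant-zero = substOccA-const s P

  interpolant-last : interpolant (occA v P) ≡ P [ v / r ]
  interpolant-last = trans (substOccA-cong P (λ i → switchAt-below)) (substOccA-const r P)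

  Repl₁-interpolant : ∀ {Γ Δ} k → k < occA v P →
    Repl₁ (atom (s ≐ r) ∷ atom (interpolant k) ∷ atom (interpolant (suc k)) ∷ Γ , Δ)
          (atom (s ≐ r) ∷ atom (interpolant k) ∷ Γ , Δ)
  Repl₁-interpolant {Γ} {Δ} k k<n =
    subst₂ (λ A B → Repl₁ (atom (s ≐ r) ∷ atom A ∷ atom B ∷ Γ , Δ) (atom (s ≐ r) ∷ atom A ∷ Γ , Δ))
           (pivot-s k) (pivot-r k)
           (repl₁ s r (pivot k) v Γ Δ s-fresh r-fresh (occA-pivot k<n))

lemma2 : ∀ (s r : Term) (P : Atom) (v : Var) (Γ Δ : List Formula) →
           occT v s ≡ 0 → occT v r ≡ 0 → 1 ≤ occA v P →
           Derives (Repl₁ ∪ᴿ LW)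
             (atom (s ≐ r) ∷ atom (P [ v / s ]) ∷ atom (P [ v / r ]) ∷ Γ , Δ)
             (atom (s ≐ r) ∷ atom (P [ v / s ]) ∷ Γ , Δ)
lemma2 s r P v Γ Δ s-fresh r-fresh 1≤n =
  subst₂ (λ A B → Derives (Repl₁ ∪ᴿ LW) (s≐r ∷ atom A ∷ atom B ∷ Γ , Δ) (s≐r ∷ atom A ∷ Γ , Δ))
         interpolant-zero interpolant-last
         (drop-chain-end s≐r (atom ∘ interpolant) (occA v P) Repl₁-interpolant Γ 1≤n)
  where
    open Interpolation v s r s-fresh r-fresh P
    s≐r : Formula
    s≐r = atom (s ≐ r)
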